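{- Let $n\ge 3$ and let $\mathbf{a}=(a_1,\dots,a_n)\in\mathbb{Z}^n$ satisfy $\left(\sum_i a_i\right)^2-\sum_i a_i-4\sum_{i<j}a_ia_j=0$. For $1\le i<j\le n$ let $s_{ij}(\mathbf{a})=\sum_{k\ne i,j}a_k$. Then the numbers $2s_{ij}(\mathbf{a})+1$ ($1\le i<j\le n$) all have the same sign. In particular, the coordinates of an integer solution of this equation for $n=3$ are either all non-negative or all negative. -}

module Defs where

open import Data.Nat using (ℕ)
open import Data.Fin using (Fin; zero; suc)
open import Relation.Binary.PropositionalEquality using (_≡_)
open import Data.Fin.Properties using (_≟_)
open import Data.Integer using (ℤ; _+_; _-_; _*_; +_; 0ℤ)
open import Relation.Nullary using (yes; no)

sumFin : {n : ℕ} → (Fin n → ℤ) → ℤ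
sumFin {ℕ.zero}  f = 0ℤ
sumFin {ℕ.suc n} f = f zero + sumFin (λ i → f (suc i))

pairSum : {n : ℕ} → (Fin n → ℤ) → ℤ
pairSum {ℕ.zero}  a = 0ℤ
pairSum {ℕ.suc n} a =
  a zero * sumFin (λ i → a (suc i)) + pairSum (λ i → a (suc i))

IsSolution : {n : ℕ} → (Fin n → ℤ) → Set
IsSolution a = sumFin a * sumFin a - sumFin a - (+ 4) * pairSum a ≡ 0ℤ

s : {n : ℕ} → (Fin n → ℤ) → Fin n → Fin n → ℤ
s a i j = sumFin (λ k → drop k)
  where
  drop : _ → ℤ
  drop k with k ≟ i | k ≟ j
  ... | yes _ | _     = 0ℤ
  ... | no _  | yes _ = 0ℤ
  ... | no _  | no _  = a k

-- Write S = Σ a_k, Q = Σ a_k² and use 2 Σ_{i<j} a_i a_j = S² − Q: the equation becomes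
-- S² + S = 2Q. Fix i ≠ j, put x = a_i, y = a_j, r = s_ij and R = Σ_{k≠i,j} a_k². Then
-- S = x + y + r and the equation rearranges to
--   S (2r + 1) = (x − y)² + 2R + r² ≥ r².
-- If S ≥ 0 and r < 0 the left side is ≤ 0 < r²; if S < 0 and r ≥ 0 it is < 0 ≤ r².
-- So every 2s_ij + 1 has the sign of S (counting S = 0 as positive). For n = 3,
-- s_ij is the remaining coordinate a_k, and 2a_k + 1 has the sign of a_k.
module Submission where

open import Defs
open import Data.Nat using (ℕ; _≥_; z≤n; s≤s)
open import Data.Fin using (Fin; _<_; zero; suc)
open import Data.Fin.Properties using (_≟_; <⇒≢)
open import Data.Integer using (ℤ; _+_; _-_; _*_; +_; -[1+_]; 0ℤ; 1ℤ; +≤+; +<+; -<+)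
import Data.Integer
open import Data.Integer.Properties
  using (≤-refl; ≤-trans; <⇒≤; ≰⇒>; ≤-<-trans; <-≤-trans; <-irrefl; +-mono-≤; +-monoˡ-≤;
         *-monoˡ-≤-nonNeg; *-monoˡ-<-neg; *-zeroʳ; pos-*; +-identityˡ; +-identityʳ; +-inverseʳ)
open import Data.Integer.Tactic.RingSolver using (solve-∀)
open import Data.Product using (_×_; _,_; Σ-syntax)
open import Data.Sum using (_⊎_; inj₁; inj₂)
open import Data.Empty using (⊥-elim)
open import Relation.Nullary using (yes; no)
open import Relation.Binary.PropositionalEquality
  using (_≡_; _≢_; refl; sym; trans; cong; cong₂; subst; subst₂; module ≡-Reasoning)

open Data.Integer using (_≤_; _≤?_) renaming (_<_ to _<ℤ_)

square-nonNeg : ∀ x → 0ℤ ≤ x * x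
square-nonNeg (+ m)    = subst (0ℤ ≤_) (pos-* m m) (+≤+ z≤n)
square-nonNeg -[1+ m ] = +≤+ z≤n

2v+1≡1+2v : ∀ v → + 2 * v + 1ℤ ≡ 1ℤ + (v + v)
2v+1≡1+2v = solve-∀

0≤v⇒0<2v+1 : ∀ v → 0ℤ ≤ v → 0ℤ <ℤ + 2 * v + 1ℤ
0≤v⇒0<2v+1 (+ m) _ = subst (0ℤ <ℤ_) (sym (2v+1≡1+2v (+ m))) (+<+ (s≤s z≤n))

v<0⇒2v+1<0 : ∀ v → v <ℤ 0ℤ → + 2 * v + 1ℤ <ℤ 0ℤ
v<0⇒2v+1<0 -[1+ m ] _         = subst (_<ℤ 0ℤ) (sym (2v+1≡1+2v -[1+ m ])) -<+
v<0⇒2v+1<0 (+ m)    (+<+ ())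

0<2v+1⇒0≤v : ∀ v → 0ℤ <ℤ + 2 * v + 1ℤ → 0ℤ ≤ v
0<2v+1⇒0≤v (+ m)    _   = +≤+ z≤n
0<2v+1⇒0≤v -[1+ m ] 0<t with subst (0ℤ <ℤ_) (2v+1≡1+2v -[1+ m ]) 0<t
... | ()

2v+1<0⇒v<0 : ∀ v → + 2 * v + 1ℤ <ℤ 0ℤ → v <ℤ 0ℤ
2v+1<0⇒v<0 -[1+ m ] _   = -<+
2v+1<0⇒v<0 (+ m)    t<0 with subst (_<ℤ 0ℤ) (2v+1≡1+2v (+ m)) t<0
... | +<+ ()

-- In each lemma, the sign of r that is not claimed would put S (2r + 1) below r².
0≤S⇒0<2r+1 : ∀ S r → r * r ≤ S * (+ 2 * r + 1ℤ) → 0ℤ ≤ S → 0ℤ <ℤ + 2 * r + 1ℤ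
0≤S⇒0<2r+1 S      (+ m)    _     _               = 0≤v⇒0<2v+1 (+ m) (+≤+ z≤n)
0≤S⇒0<2r+1 .(+ s) -[1+ m ] r²≤St (+≤+ {n = s} _) =
  ⊥-elim (<-irrefl refl (<-≤-trans (+<+ (s≤s z≤n)) (≤-trans r²≤St St≤0)))
  where
  St≤0 : + s * (+ 2 * -[1+ m ] + 1ℤ) ≤ 0ℤ
  St≤0 = subst (+ s * (+ 2 * -[1+ m ] + 1ℤ) ≤_) (*-zeroʳ (+ s))
           (*-monoˡ-≤-nonNeg (+ s) (<⇒≤ (v<0⇒2v+1<0 -[1+ m ] -<+)))

S<0⇒2r+1<0 : ∀ S r → r * r ≤ S * (+ 2 * r + 1ℤ) → S <ℤ 0ℤ → + 2 * r + 1ℤ <ℤ 0ℤ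
S<0⇒2r+1<0 S        -[1+ m ] _     _ = v<0⇒2v+1<0 -[1+ m ] -<+
S<0⇒2r+1<0 (+ s)    (+ m)    _     (+<+ ())
S<0⇒2r+1<0 -[1+ s ] (+ m)    r²≤St _ =
  ⊥-elim (<-irrefl refl (≤-<-trans (≤-trans (square-nonNeg (+ m)) r²≤St) St<0))
  where
  St<0 : -[1+ s ] * (+ 2 * + m + 1ℤ) <ℤ 0ℤ
  St<0 = subst (-[1+ s ] * (+ 2 * + m + 1ℤ) <ℤ_) (*-zeroʳ -[1+ s ])
           (*-monoˡ-<-neg -[1+ s ] (0≤v⇒0<2v+1 (+ m) (+≤+ z≤n)))

sumFin-cong : ∀ {n} {f g : Fin n → ℤ} → (∀ k → f k ≡ g k) → sumFin f ≡ sumFin g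
sumFin-cong {ℕ.zero}  f≗g = refl
sumFin-cong {ℕ.suc n} f≗g = cong₂ _+_ (f≗g zero) (sumFin-cong (λ k → f≗g (suc k)))

sumFin-nonNeg : ∀ {n} (f : Fin n → ℤ) → (∀ k → 0ℤ ≤ f k) → 0ℤ ≤ sumFin f
sumFin-nonNeg {ℕ.zero}  f 0≤f = ≤-refl
sumFin-nonNeg {ℕ.suc n} f 0≤f =
  +-mono-≤ (0≤f zero) (sumFin-nonNeg (λ k → f (suc k)) (λ k → 0≤f (suc k)))

sumSq : ∀ {n} → (Fin n → ℤ) → ℤ
sumSq a = sumFin (λ k → a k * a k)

sumSq-nonNeg : ∀ {n} (a : Fin n → ℤ) → 0ℤ ≤ sumSq a
sumSq-nonNeg a = sumFin-nonNeg (λ k → a k * a k) (λ k → square-nonNeg (a k))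

erase : ∀ {n} → Fin n → (Fin n → ℤ) → Fin n → ℤ
erase i f k with k ≟ i
... | yes _ = 0ℤ
... | no  _ = f k

erase-self : ∀ {n} (i : Fin n) (f : Fin n → ℤ) → erase i f i ≡ 0ℤ
erase-self i f with i ≟ i
... | yes _   = refl
... | no  i≢i = ⊥-elim (i≢i refl)

erase-≢ : ∀ {n} (i j : Fin n) (f : Fin n → ℤ) → j ≢ i → erase i f j ≡ f j
erase-≢ i j f j≢i with j ≟ i
... | yes j≡i = ⊥-elim (j≢i j≡i)
... | no  _   = refl

erase-suc : ∀ {n} (i : Fin n) (f : Fin (ℕ.suc n) → ℤ) (k : Fin n) →
  erase (suc i) f (suc k) ≡ erase i (λ m → f (suc m)) k
erase-suc i f k with k ≟ i
... | yes _ = refl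
... | no  _ = refl

erase-cong : ∀ {n} (i : Fin n) {f g : Fin n → ℤ} → (∀ k → f k ≡ g k) →
  ∀ k → erase i f k ≡ erase i g k
erase-cong i f≗g k with k ≟ i
... | yes _ = refl
... | no  _ = f≗g k

erase-map : ∀ {n} (g : ℤ → ℤ) → g 0ℤ ≡ 0ℤ → (i : Fin n) (f : Fin n → ℤ) (k : Fin n) →
  erase i (λ m → g (f m)) k ≡ g (erase i f k)
erase-map g g0≡0 i f k with k ≟ i
... | yes _ = sym g0≡0
... | no  _ = refl

sumFin-erase : ∀ {n} (f : Fin n → ℤ) i → sumFin f ≡ f i + sumFin (erase i f)
sumFin-erase {ℕ.suc n} f zero    = cong (λ u → f zero + u) (sym (+-identityˡ _))
sumFin-erase {ℕ.suc n} f (suc i) = begin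
  f zero + sumFin tail                         ≡⟨ cong (λ u → f zero + u) (sumFin-erase tail i) ⟩
  f zero + (f (suc i) + sumFin (erase i tail)) ≡⟨ x+[y+z]≡y+[x+z] (f zero) (f (suc i)) _ ⟩
  f (suc i) + (f zero + sumFin (erase i tail)) ≡⟨ cong (λ u → f (suc i) + (f zero + u))
                                                    (sym (sumFin-cong (erase-suc i f))) ⟩
  f (suc i) + sumFin (erase (suc i) f)         ∎
  where
  open ≡-Reasoning
  tail : Fin n → ℤ
  tail m = f (suc m)
  x+[y+z]≡y+[x+z] : ∀ x y z → x + (y + z) ≡ y + (x + z)
  x+[y+z]≡y+[x+z] = solve-∀

sumFin-erase₂ : ∀ {n} (f : Fin n → ℤ) {i j} → i ≢ j →
  sumFin f ≡ f i + (f j + sumFin (erase j (erase i f)))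
sumFin-erase₂ f {i} {j} i≢j = trans (sumFin-erase f i)
  (cong (λ u → f i + u) (trans (sumFin-erase (erase i f) j)
    (cong (λ u → u + sumFin (erase j (erase i f))) (erase-≢ i j f (λ j≡i → i≢j (sym j≡i))))))

s≡sum-erase₂ : ∀ {n} (a : Fin n → ℤ) i j → s a i j ≡ sumFin (erase j (erase i a))
s≡sum-erase₂ a i j = s≡
  where
  -- The left-hand side is the summand of s, local to its definition; it is
  -- inferred from the use of pointwise in s≡, which is therefore checked first.
  pointwise : ∀ k → _ ≡ erase j (erase i a) k
  s≡ : s a i j ≡ sumFin (erase j (erase i a))
  s≡ = sumFin-cong pointwise
  pointwise k with k ≟ i | k ≟ j
  ... | yes _    | yes _ = refl
  ... | yes refl | no  _ = sym (erase-self i a)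
  ... | no  _    | yes _ = refl
  ... | no  k≢i  | no  _ = sym (erase-≢ i k a k≢i)

sumFin-split : ∀ {n} (a : Fin n → ℤ) {i j} → i ≢ j → sumFin a ≡ a i + (a j + s a i j)
sumFin-split a {i} {j} i≢j =
  trans (sumFin-erase₂ a i≢j) (cong (λ u → a i + (a j + u)) (sym (s≡sum-erase₂ a i j)))

sumSq-split : ∀ {n} (a : Fin n → ℤ) {i j} → i ≢ j →
  sumSq a ≡ a i * a i + (a j * a j + sumSq (erase j (erase i a)))
sumSq-split a {i} {j} i≢j =
  trans (sumFin-erase₂ (λ k → a k * a k) i≢j)
        (cong (λ u → a i * a i + (a j * a j + u)) (sumFin-cong erase₂-square))
  where
  square : ℤ → ℤ
  square v = v * v
  erase₂-square : ∀ k → erase j (erase i (λ m → square (a m))) k ≡ square (erase j (erase i a) k)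
  erase₂-square k =
    trans (erase-cong j (erase-map square refl i a) k) (erase-map square refl j (erase i a) k)

pairSum-double : ∀ {n} (a : Fin n → ℤ) → + 2 * pairSum a ≡ sumFin a * sumFin a - sumSq a
pairSum-double {ℕ.zero}  a = refl
pairSum-double {ℕ.suc n} a = begin
  + 2 * (x * T + pairSum tail)        ≡⟨ distrib x T (pairSum tail) ⟩
  + 2 * x * T + + 2 * pairSum tail    ≡⟨ cong (λ u → + 2 * x * T + u) (pairSum-double tail) ⟩
  + 2 * x * T + (T * T - sumSq tail)  ≡⟨ complete-square x T (sumSq tail) ⟩
  (x + T) * (x + T) - (x * x + sumSq tail) ∎
  where
  open ≡-Reasoning
  x = a zero
  tail : Fin n → ℤ
  tail k = a (suc k)
  T = sumFin tail
  distrib : ∀ x T P → + 2 * (x * T + P) ≡ + 2 * x * T + + 2 * P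
  distrib = solve-∀
  complete-square : ∀ x T Q → + 2 * x * T + (T * T - Q) ≡ (x + T) * (x + T) - (x * x + Q)
  complete-square = solve-∀

IsSolution⇒S²+S≡2Q : ∀ {n} (a : Fin n → ℤ) → IsSolution a →
  sumFin a * sumFin a + sumFin a ≡ + 2 * sumSq a
IsSolution⇒S²+S≡2Q a sol = begin
  S * S + S
    ≡⟨ expand S (pairSum a) ⟩
  + 2 * (S * S - + 2 * pairSum a) - (S * S - S - + 4 * pairSum a)
    ≡⟨ cong₂ (λ u v → + 2 * (S * S - u) - v) (pairSum-double a) sol ⟩
  + 2 * (S * S - (S * S - sumSq a)) - 0ℤ
    ≡⟨ simplify S (sumSq a) ⟩
  + 2 * sumSq a
    ∎
  where
  open ≡-Reasoning
  S = sumFin a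
  expand : ∀ S P → S * S + S ≡ + 2 * (S * S - + 2 * P) - (S * S - S - + 4 * P)
  expand = solve-∀
  simplify : ∀ S Q → + 2 * (S * S - (S * S - Q)) - 0ℤ ≡ + 2 * Q
  simplify = solve-∀

S[2r+1]-identity : ∀ x y r R → let S = x + (y + r) in
  S * S + S ≡ + 2 * (x * x + (y * y + R)) →
  S * (+ 2 * r + 1ℤ) ≡ ((x - y) * (x - y) + + 2 * R) + r * r
S[2r+1]-identity x y r R S²+S≡2Q = begin
  S * (+ 2 * r + 1ℤ)                 ≡⟨ expand x y r R ⟩
  X + r * r + ((S * S + S) - + 2 * Q) ≡⟨ cong (λ u → X + r * r + (u - + 2 * Q)) S²+S≡2Q ⟩
  X + r * r + (+ 2 * Q - + 2 * Q)     ≡⟨ cong (λ u → X + r * r + u) (+-inverseʳ (+ 2 * Q)) ⟩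
  X + r * r + 0ℤ                      ≡⟨ +-identityʳ _ ⟩
  X + r * r                           ∎
  where
  open ≡-Reasoning
  S = x + (y + r)
  Q = x * x + (y * y + R)
  X = (x - y) * (x - y) + + 2 * R
  expand : ∀ x y r R →
    (x + (y + r)) * (+ 2 * r + 1ℤ) ≡
      ((x - y) * (x - y) + + 2 * R) + r * r
        + (((x + (y + r)) * (x + (y + r)) + (x + (y + r))) - + 2 * (x * x + (y * y + R)))
  expand = solve-∀

s²≤S[2s+1] : ∀ {n} (a : Fin n → ℤ) → IsSolution a → ∀ {i j} → i ≢ j →
  s a i j * s a i j ≤ sumFin a * (+ 2 * s a i j + 1ℤ)
s²≤S[2s+1] a sol {i} {j} i≢j =
  subst (λ S → r * r ≤ S * (+ 2 * r + 1ℤ)) (sym (sumFin-split a i≢j)) r²≤X+r²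
  where
  r = s a i j
  R = sumSq (erase j (erase i a))
  S²+S≡2Q : (a i + (a j + r)) * (a i + (a j + r)) + (a i + (a j + r))
              ≡ + 2 * (a i * a i + (a j * a j + R))
  S²+S≡2Q = subst₂ (λ S Q → S * S + S ≡ + 2 * Q) (sumFin-split a i≢j) (sumSq-split a i≢j)
              (IsSolution⇒S²+S≡2Q a sol)
  0≤X : 0ℤ ≤ (a i - a j) * (a i - a j) + + 2 * R
  0≤X = +-mono-≤ (square-nonNeg (a i - a j))
                 (*-monoˡ-≤-nonNeg (+ 2) (sumSq-nonNeg (erase j (erase i a))))
  r²≤X+r² : r * r ≤ (a i + (a j + r)) * (+ 2 * r + 1ℤ)
  r²≤X+r² = subst (r * r ≤_) (sym (S[2r+1]-identity (a i) (a j) r R S²+S≡2Q))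
              (subst (_≤ (a i - a j) * (a i - a j) + + 2 * R + r * r) (+-identityˡ (r * r))
                (+-monoˡ-≤ (r * r) 0≤X))

2s+1-OneSign : ∀ {n} → (Fin n → ℤ) → Set
2s+1-OneSign {n} a = (∀ (i j : Fin n) → i < j → 0ℤ <ℤ + 2 * s a i j + 1ℤ)
                   ⊎ (∀ (i j : Fin n) → i < j → + 2 * s a i j + 1ℤ <ℤ 0ℤ)

IsSolution⇒2s+1-OneSign : ∀ {n} (a : Fin n → ℤ) → IsSolution a → 2s+1-OneSign a
IsSolution⇒2s+1-OneSign a sol with 0ℤ ≤? sumFin a
... | yes 0≤S = inj₁ λ i j i<j →
  0≤S⇒0<2r+1 (sumFin a) (s a i j) (s²≤S[2s+1] a sol (<⇒≢ i<j)) 0≤S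
... | no  0≰S = inj₂ λ i j i<j →
  S<0⇒2r+1<0 (sumFin a) (s a i j) (s²≤S[2s+1] a sol (<⇒≢ i<j)) (≰⇒> 0≰S)

s-complement₃ : (a : Fin 3 → ℤ) (k : Fin 3) →
  Σ[ i ∈ Fin 3 ] Σ[ j ∈ Fin 3 ] i < j × s a i j ≡ a k
s-complement₃ a zero             = suc zero , suc (suc zero) , s≤s (s≤s z≤n) , +-identityʳ (a zero)
s-complement₃ a (suc zero)       = zero , suc (suc zero) , s≤s z≤n ,
  trans (+-identityˡ _) (+-identityʳ (a (suc zero)))
s-complement₃ a (suc (suc zero)) = zero , suc zero , s≤s z≤n ,
  trans (+-identityˡ _) (trans (+-identityˡ _) (+-identityʳ (a (suc (suc zero)))))

2s+1-OneSign⇒OneSign₃ : (a : Fin 3 → ℤ) → 2s+1-OneSign a →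
  (∀ k → 0ℤ ≤ a k) ⊎ (∀ k → a k <ℤ 0ℤ)
2s+1-OneSign⇒OneSign₃ a (inj₁ 0<2s+1) = inj₁ λ k →
  let i , j , i<j , s≡aₖ = s-complement₃ a k
  in 0<2v+1⇒0≤v (a k) (subst (λ v → 0ℤ <ℤ + 2 * v + 1ℤ) s≡aₖ (0<2s+1 i j i<j))
2s+1-OneSign⇒OneSign₃ a (inj₂ 2s+1<0) = inj₂ λ k →
  let i , j , i<j , s≡aₖ = s-complement₃ a k
  in 2v+1<0⇒v<0 (a k) (subst (λ v → + 2 * v + 1ℤ <ℤ 0ℤ) s≡aₖ (2s+1<0 i j i<j))

proposition4p1 : (n : ℕ) → n ≥ 3 → (a : Fin n → ℤ) → IsSolution a →
    ((∀ (i j : Fin n) → i < j → 0ℤ Data.Integer.< (+ 2) * s a i j + 1ℤ)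
    ⊎ (∀ (i j : Fin n) → i < j → (+ 2) * s a i j + 1ℤ Data.Integer.< 0ℤ))
    × ((n ≡ 3) → (∀ k → 0ℤ Data.Integer.≤ a k) ⊎ (∀ k → a k Data.Integer.< 0ℤ))
proposition4p1 n _ a sol = one-sign , λ { refl → 2s+1-OneSign⇒OneSign₃ a one-sign }
  where
  one-sign : 2s+1-OneSign a
  one-sign = IsSolution⇒2s+1-OneSign a sol
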